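{- Let $p=(123,\emptyset,\emptyset)$ (the classical pattern $123$) and $r=(312,\emptyset,\{1\})$. Then for every $n\ge 1$, $|\mathrm{Av}_n(p,r)|=2^{n-1}$.
   Context: For $n\ge 0$, $\mathcal{S}_n$ is the set of permutations of $[n]=\{1,\dots,n\}$, written as words $\pi=\pi(1)\pi(2)\cdots\pi(n)$. Two words of distinct integers of the same length are order-isomorphic if their entries appear in the same relative order. A pattern of length 3 is a triple $(\sigma,X,Y)$ with $\sigma\in\mathcal{S}_3$ and $X,Y\subseteq\{1,2\}$. A permutation $\pi\in\mathcal{S}_n$ contains $(\sigma,X,Y)$ if there are indices $i_1<i_2<i_3$ such that $\pi(i_1)\pi(i_2)\pi(i_3)$ is order-isomorphic to $\sigma$, $i_{x+1}=i_x+1$ for every $x\in X$, and $j_{y+1}=j_y+1$ for every $y\in Y$, where $j_1<j_2<j_3$ are the three values $\pi(i_1),\pi(i_2),\pi(i_3)$ listed in increasing order; otherwise $\pi$ avoids it. For patterns $P_1,\dots,P_m$, $\mathrm{Av}_n(P_1,\dots,P_m)$ is the set of $\pi\in\mathcal{S}_n$ avoiding every $P_i$. -}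

module Defs where

open import Data.Nat using (ℕ; suc)
open import Data.Fin using (Fin; zero; suc; toℕ; inject₁; _<_)
open import Data.Fin.Subset using (Subset; _∈_; ⁅_⁆; ⊥)
open import Data.Vec using (Vec; lookup; _∷_; [])
open import Data.Vec.Relation.Unary.Unique.Propositional using (Unique)
open import Data.Product using (Σ; _×_)
open import Relation.Binary.PropositionalEquality using (_≡_)
open import Relation.Nullary using (¬_)
open import Function.Bundles using (_⇔_)

-- A permutation of [n] written as a word π(1)…π(n); the value k+1 is
-- encoded as the element k of Fin n (0-based).  A word of length n over
-- an n-element alphabet with pairwise distinct entries is a permutation.
IsPerm : ∀ {n} → Vec (Fin n) n → Set
IsPerm π = Unique π

-- A pattern of length 3: (σ , X , Y) with σ ∈ S₃ (as a word over Fin 3,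
-- 0-based values) and X, Y ⊆ {1,2}, encoded as subsets of Fin 2
-- (element x : Fin 2 stands for x+1).
record Pattern : Set where
  constructor pat
  field
    σ : Vec (Fin 3) 3
    X : Subset 2
    Y : Subset 2

-- Because of order
-- isomorphism, the y-th smallest value sits at the position a with σ(a) = y.
Contains : ∀ {n} → Vec (Fin n) n → Pattern → Set
Contains {n} π (pat σ X Y) =
  Σ (Fin 3 → Fin n) λ i →
    (∀ a b → a < b → i a < i b)
  × (∀ a b → (lookup π (i a) < lookup π (i b)) ⇔ (lookup σ a < lookup σ b))
  × (∀ x → x ∈ X → toℕ (i (suc x)) ≡ suc (toℕ (i (inject₁ x))))
  × (∀ y a b → y ∈ Y → lookup σ a ≡ inject₁ y → lookup σ b ≡ suc y →
       toℕ (lookup π (i b)) ≡ suc (toℕ (lookup π (i a))))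

Avoids : ∀ {n} → Vec (Fin n) n → Pattern → Set
Avoids π P = ¬ Contains π P

p : Pattern
p = pat (zero ∷ suc zero ∷ suc (suc zero) ∷ []) ⊥ ⊥

r : Pattern
r = pat (suc (suc zero) ∷ zero ∷ suc zero ∷ []) ⊥ ⁅ zero ⁆

-- Elements of Av_n(p, r).  The proofs are irrelevant, so two elements are
-- equal exactly when their words are equal; hence a bijection with Fin k
-- says precisely |Av_n(p, r)| = k.
record Av-p-r (n : ℕ) : Set where
  constructor av
  field
    word     : Vec (Fin n) n
    .isPerm  : IsPerm word
    .avoid-p : Avoids word p
    .avoid-r : Avoids word r

-- In an avoider, the entries after the first one that lie above it decrease, or 123 would
-- occur.  Those below it decrease as well: for an ascent π(i) < π(j) < π(1) with minimal gap,
-- the value π(i)+1 sits either before i (giving a smaller gap) or after i, where it forms an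
-- occurrence of r together with π(1) and π(i).  Hence an avoider is determined by the n−1 bits
-- telling which entries lie above the first one; conversely, for any bits the word forced by
-- these rules has no increasing triple, and the 1 and 2 of any 312 in it lie on opposite sides
-- of the first entry, so their values are not adjacent.

module Submission where

open import Defs
open import Data.Bool using (Bool; true; false; if_then_else_)
import Data.Bool.Properties as Bool
open import Data.Empty using (⊥; ⊥-elim)
open import Data.Fin using (Fin; zero; suc; toℕ; fromℕ<; inject₁; punchOut)
open import Data.Fin.Properties as Fin using (toℕ-injective; toℕ-fromℕ<; toℕ<n; toℕ-inject₁)
open import Data.Fin.Subset using (_∈_)
open import Data.Fin.Subset.Properties using (∉⊥; x∈⁅x⁆; x∈⁅y⁆⇒x≡y)
open import Data.Nat using (ℕ; zero; suc; _+_; _∸_; _^_; _≤_; _<_; z≤n; s≤s)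
open import Data.Nat.Properties
open import Data.Product as Product using (_×_; _,_; proj₁; proj₂; ∃)
open import Data.Sum as Sum using (_⊎_; inj₁; inj₂)
open import Data.Vec using (Vec; []; _∷_; lookup; tabulate)
open import Data.Vec.Properties as Vec using (lookup∘tabulate; tabulate∘lookup; tabulate-cong)
open import Data.Vec.Relation.Unary.Unique.Propositional using (Unique)
open import Data.Vec.Relation.Unary.Unique.Propositional.Properties using (lookup-injective; tabulate⁺)
open import Function using (_∘_)
open import Function.Bundles using (_⇔_; mk⇔; Equivalence; _↔_; mk↔ₛ′)
open import Function.Properties.Inverse using (↔-trans; ↔-sym)
open import Data.Product.Function.NonDependent.Propositional using (_×-↔_)
open import Function.Definitions using (Injective)
open import Relation.Binary using (tri<; tri≈; tri>)
open import Relation.Binary.PropositionalEquality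
open import Relation.Nullary using (¬_; yes; no; does; proof)
open import Relation.Nullary.Decidable using (dec-true; dec-false; recompute)
open import Relation.Nullary.Reflects using (Reflects; invert)

pattern 0F = zero
pattern 1F = suc 0F
pattern 2F = suc 1F

injective⇒surjective : ∀ {n} (f : Fin n → Fin n) → Injective _≡_ _≡_ f → ∀ y → ∃ λ x → f x ≡ y
injective⇒surjective {suc n} f f-inj y with Fin.any? (λ x → f x Fin.≟ y)
... | yes hit = hit
... | no miss = ⊥-elim (1+n≰n (Fin.injective⇒≤ g-inj))
  where
  f≢y : ∀ x → y ≢ f x
  f≢y x e = miss (x , sym e)
  g : Fin (suc n) → Fin n
  g x = punchOut (f≢y x)
  g-inj : Injective _≡_ _≡_ g
  g-inj e = f-inj (Fin.punchOut-injective (f≢y _) (f≢y _) e)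

increasing⇒inflationary : ∀ {n} (h : Fin n → Fin n) →
                          (∀ a b → toℕ a < toℕ b → toℕ (h a) < toℕ (h b)) →
                          ∀ a → toℕ a ≤ toℕ (h a)
increasing⇒inflationary h h-incr a = go (toℕ a) a refl
  where
  go : ∀ k a → toℕ a ≡ k → k ≤ toℕ (h a)
  go zero    a        _ = z≤n
  go (suc k) (suc a′) e =
    ≤-<-trans (go k (inject₁ a′) (trans (toℕ-inject₁ a′) (suc-injective e)))
              (h-incr (inject₁ a′) (suc a′) (s≤s (≤-reflexive (toℕ-inject₁ a′))))

-- g⁻¹ exists by surjectivity, and f ∘ g⁻¹ is increasing, hence inflationary.
order-preserving⇒≤ : ∀ {n} (f g : Fin n → Fin n) → Injective _≡_ _≡_ g →
                     (∀ i j → toℕ (g i) < toℕ (g j) → toℕ (f i) < toℕ (f j)) →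
                     ∀ i → toℕ (g i) ≤ toℕ (f i)
order-preserving⇒≤ f g g-inj g⇒f i =
  subst (λ x → toℕ (g i) ≤ toℕ (f x)) (g-inj (g∘g⁻¹ (g i)))
        (increasing⇒inflationary (f ∘ g⁻¹) f∘g⁻¹-incr (g i))
  where
  g⁻¹ : Fin _ → Fin _
  g⁻¹ y = proj₁ (injective⇒surjective g g-inj y)
  g∘g⁻¹ : ∀ y → g (g⁻¹ y) ≡ y
  g∘g⁻¹ y = proj₂ (injective⇒surjective g g-inj y)
  f∘g⁻¹-incr : ∀ a b → toℕ a < toℕ b → toℕ (f (g⁻¹ a)) < toℕ (f (g⁻¹ b))
  f∘g⁻¹-incr a b a<b = g⇒f (g⁻¹ a) (g⁻¹ b)
    (subst₂ (λ u v → toℕ u < toℕ v) (sym (g∘g⁻¹ a)) (sym (g∘g⁻¹ b)) a<b)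

order-isomorphic⇒≡ : ∀ {n} (f g : Fin n → Fin n) → Injective _≡_ _≡_ f → Injective _≡_ _≡_ g →
                     (∀ i j → toℕ (f i) < toℕ (f j) → toℕ (g i) < toℕ (g j)) →
                     (∀ i j → toℕ (g i) < toℕ (g j) → toℕ (f i) < toℕ (f j)) →
                     ∀ i → f i ≡ g i
order-isomorphic⇒≡ f g f-inj g-inj f⇒g g⇒f i =
  toℕ-injective (≤-antisym (order-preserving⇒≤ g f f-inj f⇒g i) (order-preserving⇒≤ f g g-inj g⇒f i))

Respects : ∀ {n} → (Fin n → Fin n → Set) → (Fin n → ℕ) → Set
Respects R f = ∀ x y → R x y → f x < f y

module _ {n} {R : Fin n → Fin n → Set} (R-connex : ∀ x y → x ≢ y → R x y ⊎ R y x)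
         {f : Fin n → ℕ} (f-resp : Respects R f) where

  respects⇒reflects : ∀ x y → f x < f y → R x y
  respects⇒reflects x y fx<fy with x Fin.≟ y
  ... | yes refl = ⊥-elim (<-irrefl refl fx<fy)
  ... | no x≢y with R-connex x y x≢y
  ...   | inj₁ Rxy = Rxy
  ...   | inj₂ Ryx = ⊥-elim (<-asym fx<fy (f-resp y x Ryx))

  respects⇒injective : ∀ {x y} → f x ≡ f y → x ≡ y
  respects⇒injective {x} {y} fx≡fy with x Fin.≟ y
  ... | yes x≡y = x≡y
  ... | no x≢y with R-connex x y x≢y
  ...   | inj₁ Rxy = ⊥-elim (<-irrefl fx≡fy (f-resp x y Rxy))
  ...   | inj₂ Ryx = ⊥-elim (<-irrefl (sym fx≡fy) (f-resp y x Ryx))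

triple : ∀ {A : Set} → A → A → A → Fin 3 → A
triple x y z 0F = x
triple x y z 1F = y
triple x y z 2F = z

triple-increasing : (f : Fin 3 → ℕ) → f 0F < f 1F → f 1F < f 2F →
                    ∀ a b → toℕ a < toℕ b → f a < f b
triple-increasing f f₀<f₁ f₁<f₂ 0F 1F _ = f₀<f₁
triple-increasing f f₀<f₁ f₁<f₂ 0F 2F _ = <-trans f₀<f₁ f₁<f₂
triple-increasing f f₀<f₁ f₁<f₂ 1F 2F _ = f₁<f₂
triple-increasing f f₀<f₁ f₁<f₂ 0F 0F ()
triple-increasing f f₀<f₁ f₁<f₂ 1F 0F ()
triple-increasing f f₀<f₁ f₁<f₂ 1F 1F (s≤s ())
triple-increasing f f₀<f₁ f₁<f₂ 2F 0F ()
triple-increasing f f₀<f₁ f₁<f₂ 2F 1F (s≤s ())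
triple-increasing f f₀<f₁ f₁<f₂ 2F 2F (s≤s (s≤s ()))

order-isomorphic-via-inverse : ∀ {k} (σ : Vec (Fin k) k) (τ : Fin k → Fin k) →
                               (∀ a → τ (lookup σ a) ≡ a) → (f : Fin k → ℕ) →
                               (∀ a b → toℕ a < toℕ b → f (τ a) < f (τ b)) →
                               ∀ a b → (f a < f b) ⇔ (toℕ (lookup σ a) < toℕ (lookup σ b))
order-isomorphic-via-inverse σ τ τ∘σ f f∘τ-incr a b = mk⇔ reflect preserve
  where
  σ-injective : ∀ {a b} → toℕ (lookup σ a) ≡ toℕ (lookup σ b) → a ≡ b
  σ-injective {a} {b} σa≡σb = trans (sym (τ∘σ a)) (trans (cong τ (toℕ-injective σa≡σb)) (τ∘σ b))
  preserve : ∀ {a b} → toℕ (lookup σ a) < toℕ (lookup σ b) → f a < f b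
  preserve {a} {b} σa<σb = subst₂ (λ u v → f u < f v) (τ∘σ a) (τ∘σ b)
                                  (f∘τ-incr (lookup σ a) (lookup σ b) σa<σb)
  reflect : f a < f b → toℕ (lookup σ a) < toℕ (lookup σ b)
  reflect fa<fb with <-cmp (toℕ (lookup σ a)) (toℕ (lookup σ b))
  ... | tri< σa<σb _ _ = σa<σb
  ... | tri≈ _ σa≡σb _ = ⊥-elim (<-irrefl (cong f (σ-injective σa≡σb)) fa<fb)
  ... | tri> _ _ σb<σa = ⊥-elim (<-asym fa<fb (preserve σb<σa))

entry : ∀ {n} → Vec (Fin n) n → Fin n → ℕ
entry π x = toℕ (lookup π x)

contains-p : ∀ {n} (π : Vec (Fin n) n) x y z → toℕ x < toℕ y → toℕ y < toℕ z →
             entry π x < entry π y → entry π y < entry π z → Contains π p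
contains-p π x y z x<y y<z πx<πy πy<πz =
    triple x y z
  , triple-increasing (toℕ ∘ triple x y z) x<y y<z
  , order-isomorphic-via-inverse (Pattern.σ p) (λ a → a) σ-is-identity (entry π ∘ triple x y z)
                                 (triple-increasing _ πx<πy πy<πz)
  , (λ _ x∈⊥ → ⊥-elim (∉⊥ x∈⊥))
  , (λ _ _ _ y∈⊥ → ⊥-elim (∉⊥ y∈⊥))
  where
  σ-is-identity : ∀ a → lookup (Pattern.σ p) a ≡ a
  σ-is-identity 0F = refl
  σ-is-identity 1F = refl
  σ-is-identity 2F = refl

contains-r : ∀ {n} (π : Vec (Fin n) n) x y z → toℕ x < toℕ y → toℕ y < toℕ z →
             entry π y < entry π z → entry π z < entry π x → entry π z ≡ suc (entry π y) →
             Contains π r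
contains-r π x y z x<y y<z πy<πz πz<πx πz≡1+πy =
    triple x y z
  , triple-increasing (toℕ ∘ triple x y z) x<y y<z
  , order-isomorphic-via-inverse (Pattern.σ r) τ τ∘σ (entry π ∘ triple x y z)
                                 (triple-increasing _ πy<πz πz<πx)
  , (λ _ x∈⊥ → ⊥-elim (∉⊥ x∈⊥))
  , values-adjacent
  where
  τ : Fin 3 → Fin 3
  τ = triple 1F 2F 0F
  τ∘σ : ∀ a → τ (lookup (Pattern.σ r) a) ≡ a
  τ∘σ 0F = refl
  τ∘σ 1F = refl
  τ∘σ 2F = refl
  values-adjacent : ∀ v a b → v ∈ Pattern.Y r →
                    lookup (Pattern.σ r) a ≡ inject₁ v → lookup (Pattern.σ r) b ≡ suc v →
                    entry π (triple x y z b) ≡ suc (entry π (triple x y z a))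
  values-adjacent v a b v∈Y with refl ← x∈⁅y⁆⇒x≡y 0F v∈Y = adjacent a b
    where
    adjacent : ∀ a b → lookup (Pattern.σ r) a ≡ 0F → lookup (Pattern.σ r) b ≡ 1F →
               entry π (triple x y z b) ≡ suc (entry π (triple x y z a))
    adjacent 1F 2F refl refl = πz≡1+πy
    adjacent 0F _  ()   _
    adjacent 2F _  ()   _
    adjacent 1F 0F _    ()
    adjacent 1F 1F _    ()

countPrefix : ∀ {m} → Bool → Vec Bool m → ℕ → ℕ
countPrefix c []       _       = 0
countPrefix c (x ∷ xs) zero    = 0
countPrefix c (x ∷ xs) (suc k) with x Bool.≟ c
... | yes _ = suc (countPrefix c xs k)
... | no  _ = countPrefix c xs k

countPrefix-mono : ∀ {m} c (bs : Vec Bool m) {i j} → i ≤ j → countPrefix c bs i ≤ countPrefix c bs j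
countPrefix-mono c []       _         = z≤n
countPrefix-mono c (x ∷ xs) {zero}  _ = z≤n
countPrefix-mono c (x ∷ xs) {suc i} {suc j} (s≤s i≤j) with x Bool.≟ c
... | yes _ = s≤s (countPrefix-mono c xs i≤j)
... | no  _ = countPrefix-mono c xs i≤j

countPrefix-step : ∀ {m} c (bs : Vec Bool m) k → lookup bs k ≡ c →
                   ∀ j → toℕ k < j → countPrefix c bs (toℕ k) < countPrefix c bs j
countPrefix-step c (x ∷ xs) zero x≡c (suc j) _ with x Bool.≟ c
... | yes _   = s≤s z≤n
... | no  x≢c = ⊥-elim (x≢c x≡c)
countPrefix-step c (x ∷ xs) (suc k) xₖ≡c (suc j) (s≤s k<j) with x Bool.≟ c
... | yes _ = s≤s (countPrefix-step c xs k xₖ≡c j k<j)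
... | no  _ = countPrefix-step c xs k xₖ≡c j k<j

countPrefix-total : ∀ {m} (bs : Vec Bool m) → countPrefix false bs m + countPrefix true bs m ≡ m
countPrefix-total []           = refl
countPrefix-total {suc m} (false ∷ xs) = cong suc (countPrefix-total xs)
countPrefix-total {suc m} (true  ∷ xs) =
  trans (+-suc (countPrefix false xs m) _) (cong suc (countPrefix-total xs))

aboveFirst : ∀ {m} → Vec (Fin (suc m)) (suc m) → Vec Bool m
aboveFirst π = tabulate (λ k → does (lookup π zero Fin.<? lookup π (suc k)))

aboveFirst-reflects : ∀ {m} (π : Vec (Fin (suc m)) (suc m)) k →
                      Reflects (entry π zero < entry π (suc k)) (lookup (aboveFirst π) k)
aboveFirst-reflects π k =
  subst (Reflects _) (sym (lookup∘tabulate (λ k → does (lookup π zero Fin.<? lookup π (suc k))) k))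
        (proof (lookup π zero Fin.<? lookup π (suc k)))

aboveFirst-true : ∀ {m} (π : Vec (Fin (suc m)) (suc m)) k →
                  lookup (aboveFirst π) k ≡ true → entry π zero < entry π (suc k)
aboveFirst-true π k bₖ≡true = invert (subst (Reflects _) bₖ≡true (aboveFirst-reflects π k))

aboveFirst-false : ∀ {m} (π : Vec (Fin (suc m)) (suc m)) k →
                   lookup (aboveFirst π) k ≡ false → ¬ entry π zero < entry π (suc k)
aboveFirst-false π k bₖ≡false = invert (subst (Reflects _) bₖ≡false (aboveFirst-reflects π k))

module ForcedOrder {m} (b : Vec Bool m) where

  High Low : Fin (suc m) → Set
  High zero    = ⊥
  High (suc k) = lookup b k ≡ true
  Low  zero    = ⊥
  Low  (suc k) = lookup b k ≡ false

  -- Below x y: entry x lies below entry y in every avoider whose bits are b.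
  Below : Fin (suc m) → Fin (suc m) → Set
  Below zero    zero    = ⊥
  Below zero    (suc j) = High (suc j)
  Below (suc i) zero    = Low (suc i)
  Below (suc i) (suc j) = (Low (suc i) × High (suc j)) ⊎ (lookup b i ≡ lookup b j × toℕ j < toℕ i)

  Below-connex-suc : ∀ i j → toℕ j < toℕ i → Below (suc i) (suc j) ⊎ Below (suc j) (suc i)
  Below-connex-suc i j j<i with lookup b i | lookup b j
  ... | false | true  = inj₁ (inj₁ (refl , refl))
  ... | true  | false = inj₂ (inj₁ (refl , refl))
  ... | true  | true  = inj₁ (inj₂ (refl , j<i))
  ... | false | false = inj₁ (inj₂ (refl , j<i))

  Below-connex : ∀ x y → x ≢ y → Below x y ⊎ Below y x
  Below-connex zero    zero    x≢y = ⊥-elim (x≢y refl)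
  Below-connex zero    (suc j) _   with lookup b j
  ... | true  = inj₁ refl
  ... | false = inj₂ refl
  Below-connex (suc i) zero    _   with lookup b i
  ... | true  = inj₂ refl
  ... | false = inj₁ refl
  Below-connex (suc i) (suc j) i≢j with <-cmp (toℕ i) (toℕ j)
  ... | tri< i<j _ _ = Sum.swap (Below-connex-suc j i i<j)
  ... | tri≈ _ i≡j _ = ⊥-elim (i≢j (cong suc (toℕ-injective i≡j)))
  ... | tri> _ _ j<i = Below-connex-suc i j j<i

  Low⇒¬High : ∀ {x} → Low x → ¬ High x
  Low⇒¬High {suc k} bₖ≡false bₖ≡true with trans (sym bₖ≡false) bₖ≡true
  ... | ()

  High⇒above-first : ∀ {z} → High z → Below zero z
  High⇒above-first {suc j} Hz = Hz

  ascent⇒High : ∀ {y z} → toℕ y < toℕ z → Below y z → High z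
  ascent⇒High {zero}  {suc j} _         Byz                = Byz
  ascent⇒High {suc i} {suc j} _         (inj₁ (_ , Hz))    = Hz
  ascent⇒High {suc i} {suc j} (s≤s i<j) (inj₂ (_ , j<i))   = ⊥-elim (<-asym i<j j<i)

  ascent⇒Low : ∀ {i z} → toℕ (suc i) < toℕ z → Below (suc i) z → Low (suc i)
  ascent⇒Low {i} {suc j} _         (inj₁ (Ly , _))  = Ly
  ascent⇒Low {i} {suc j} (s≤s i<j) (inj₂ (_ , j<i)) = ⊥-elim (<-asym i<j j<i)

  no-Below-ascent₃ : ∀ {x y z} → toℕ x < toℕ y → toℕ y < toℕ z → Below x y → Below y z → ⊥
  no-Below-ascent₃ {y = suc i} x<y y<z Bxy Byz = Low⇒¬High (ascent⇒Low y<z Byz) (ascent⇒High x<y Bxy)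

  Respecting : Vec (Fin (suc m)) (suc m) → Set
  Respecting π = Respects Below (entry π)

  module RespectingWord {π : Vec (Fin (suc m)) (suc m)} (π-resp : Respecting π) where

    respecting⇒injective : Injective _≡_ _≡_ (lookup π)
    respecting⇒injective πx≡πy = respects⇒injective Below-connex π-resp (cong toℕ πx≡πy)

    respecting⇒unique : Unique π
    respecting⇒unique = subst Unique (tabulate∘lookup π) (tabulate⁺ respecting⇒injective)

    ordered⇒Below : ∀ {x y} → entry π x < entry π y → Below x y
    ordered⇒Below = respects⇒reflects Below-connex π-resp _ _

    respecting⇒avoids-p : Avoids π p
    respecting⇒avoids-p (i , i-incr , i-order , _ , _) =
      no-Below-ascent₃ (i-incr 0F 1F (s≤s z≤n)) (i-incr 1F 2F (s≤s (s≤s z≤n)))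
        (ordered⇒Below (Equivalence.from (i-order 0F 1F) (s≤s z≤n)))
        (ordered⇒Below (Equivalence.from (i-order 1F 2F) (s≤s (s≤s z≤n))))

    respecting⇒avoids-r : Avoids π r
    respecting⇒avoids-r (i , i-incr , i-order , _ , adjacent) =
      separated (i-incr 0F 1F (s≤s z≤n))
      where
      y<z : toℕ (i 1F) < toℕ (i 2F)
      y<z = i-incr 1F 2F (s≤s (s≤s z≤n))
      Byz : Below (i 1F) (i 2F)
      Byz = ordered⇒Below (Equivalence.from (i-order 1F 2F) (s≤s z≤n))
      πz≡1+πy : entry π (i 2F) ≡ suc (entry π (i 1F))
      πz≡1+πy = adjacent 0F 1F 2F (x∈⁅x⁆ 0F) refl refl
      -- The case i 1F = zero is ruled out by x<y.
      separated : toℕ (i 0F) < toℕ (i 1F) → ⊥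
      separated x<y with i 1F | y<z | Byz | πz≡1+πy
      ... | suc k | y<z | Byz | πz≡1+πy = <-irrefl refl (begin-strict
        suc (entry π (suc k))  ≤⟨ π-resp (suc k) zero (ascent⇒Low y<z Byz) ⟩
        entry π zero           <⟨ π-resp zero _ (High⇒above-first (ascent⇒High y<z Byz)) ⟩
        entry π (i 2F)         ≡⟨ πz≡1+πy ⟩
        suc (entry π (suc k))  ∎)
        where open ≤-Reasoning

    respecting⇒aboveFirst : aboveFirst π ≡ b
    respecting⇒aboveFirst = trans (tabulate-cong bit-correct) (tabulate∘lookup b)
      where
      bit-correct : ∀ k → does (lookup π zero Fin.<? lookup π (suc k)) ≡ lookup b k
      bit-correct k with lookup b k in bₖ
      ... | true  = dec-true  (lookup π zero Fin.<? lookup π (suc k)) (π-resp zero (suc k) bₖ)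
      ... | false = dec-false (lookup π zero Fin.<? lookup π (suc k)) (<-asym (π-resp (suc k) zero bₖ))

  open RespectingWord

  respecting-unique : ∀ {π π′} → Respecting π → Respecting π′ → π ≡ π′
  respecting-unique {π} {π′} π-resp π′-resp = begin
    π                     ≡⟨ tabulate∘lookup π ⟨
    tabulate (lookup π)   ≡⟨ tabulate-cong (order-isomorphic⇒≡ (lookup π) (lookup π′)
                               (respecting⇒injective {π} π-resp) (respecting⇒injective {π′} π′-resp)
                               (transfer {π} {π′} π-resp π′-resp) (transfer {π′} {π} π′-resp π-resp)) ⟩
    tabulate (lookup π′)  ≡⟨ tabulate∘lookup π′ ⟩
    π′                    ∎
    where
    open ≡-Reasoning
    transfer : ∀ {σ τ} → Respecting σ → Respecting τ →
               ∀ i j → entry σ i < entry σ j → entry τ i < entry τ j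
    transfer σ-resp τ-resp i j σi<σj = τ-resp i j (respects⇒reflects Below-connex σ-resp i j σi<σj)

  first : ℕ
  first = countPrefix false b m

  first≤m : first ≤ m
  first≤m = ≤-trans (m≤m+n first _) (≤-reflexive (countPrefix-total b))

  decodeEntry : Fin (suc m) → ℕ
  decodeEntry zero    = first
  decodeEntry (suc k) = if lookup b k then m ∸ countPrefix true b (toℕ k)
                                      else first ∸ suc (countPrefix false b (toℕ k))

  decodeEntry-High : ∀ {k} → High (suc k) → decodeEntry (suc k) ≡ m ∸ countPrefix true b (toℕ k)
  decodeEntry-High bₖ≡true rewrite bₖ≡true = refl

  decodeEntry-Low : ∀ {k} → Low (suc k) → decodeEntry (suc k) ≡ first ∸ suc (countPrefix false b (toℕ k))
  decodeEntry-Low bₖ≡false rewrite bₖ≡false = refl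

  decodeEntry≤m : ∀ x → decodeEntry x ≤ m
  decodeEntry≤m zero    = first≤m
  decodeEntry≤m (suc k) with lookup b k
  ... | true  = m∸n≤m m (countPrefix true b (toℕ k))
  ... | false = ≤-trans (m∸n≤m first (suc (countPrefix false b (toℕ k)))) first≤m

  decode : Vec (Fin (suc m)) (suc m)
  decode = tabulate (λ x → fromℕ< (s≤s (decodeEntry≤m x)))

  entry-decode : ∀ x → entry decode x ≡ decodeEntry x
  entry-decode x = trans (cong toℕ (lookup∘tabulate (λ x → fromℕ< (s≤s (decodeEntry≤m x))) x))
                         (toℕ-fromℕ< (s≤s (decodeEntry≤m x)))

  decodeEntry-Low<first : ∀ k → Low (suc k) → decodeEntry (suc k) < first
  decodeEntry-Low<first k bₖ≡false rewrite decodeEntry-Low bₖ≡false =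
    ∸-monoʳ-< {o = 0} (s≤s z≤n) (countPrefix-step false b k bₖ≡false m (toℕ<n k))

  first<decodeEntry-High : ∀ k → High (suc k) → first < decodeEntry (suc k)
  first<decodeEntry-High k bₖ≡true rewrite decodeEntry-High bₖ≡true =
    m+n≤o⇒m≤o∸n (suc first) (begin
      suc first + countPrefix true b (toℕ k)    ≡⟨ +-suc first _ ⟨
      first + suc (countPrefix true b (toℕ k))  ≤⟨ +-monoʳ-≤ first (countPrefix-step true b k bₖ≡true m (toℕ<n k)) ⟩
      first + countPrefix true b m              ≡⟨ countPrefix-total b ⟩
      m                                         ∎)
    where open ≤-Reasoning

  decodeEntry-same-side : ∀ i j → lookup b i ≡ lookup b j → toℕ j < toℕ i →
                          decodeEntry (suc i) < decodeEntry (suc j)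
  decodeEntry-same-side i j bᵢ≡bⱼ j<i = side (lookup b i) refl
    where
    side : ∀ c → lookup b i ≡ c → decodeEntry (suc i) < decodeEntry (suc j)
    side true  bᵢ rewrite decodeEntry-High {i} bᵢ | decodeEntry-High {j} (trans (sym bᵢ≡bⱼ) bᵢ) =
      ∸-monoʳ-< (countPrefix-step true b j (trans (sym bᵢ≡bⱼ) bᵢ) (toℕ i) j<i)
                (≤-trans (countPrefix-mono true b (<⇒≤ (toℕ<n i)))
                         (≤-trans (m≤n+m _ _) (≤-reflexive (countPrefix-total b))))
    side false bᵢ rewrite decodeEntry-Low {i} bᵢ | decodeEntry-Low {j} (trans (sym bᵢ≡bⱼ) bᵢ) =
      ∸-monoʳ-< (s≤s (countPrefix-step false b j (trans (sym bᵢ≡bⱼ) bᵢ) (toℕ i) j<i))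
                (countPrefix-step false b i bᵢ m (toℕ<n i))

  decodeEntry-respects : Respects Below decodeEntry
  decodeEntry-respects zero    (suc j) Hj                 = first<decodeEntry-High j Hj
  decodeEntry-respects (suc i) zero    Li                 = decodeEntry-Low<first i Li
  decodeEntry-respects (suc i) (suc j) (inj₁ (Li , Hj))   =
    <-trans (decodeEntry-Low<first i Li) (first<decodeEntry-High j Hj)
  decodeEntry-respects (suc i) (suc j) (inj₂ (bᵢ≡bⱼ , j<i)) = decodeEntry-same-side i j bᵢ≡bⱼ j<i

  decode-respecting : Respecting decode
  decode-respecting x y Bxy =
    subst₂ _<_ (sym (entry-decode x)) (sym (entry-decode y)) (decodeEntry-respects x y Bxy)

module Avoider {m} {π : Vec (Fin (suc m)) (suc m)}
               (π-unique : Unique π) (π-avoids-p : Avoids π p) (π-avoids-r : Avoids π r) where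

  open ForcedOrder (aboveFirst π)

  π-injective : Injective _≡_ _≡_ (lookup π)
  π-injective = lookup-injective π-unique _ _

  ≮⇒> : ∀ {x y} → x ≢ y → ¬ entry π y < entry π x → entry π x < entry π y
  ≮⇒> x≢y πy≮πx = ≤∧≢⇒< (≮⇒≥ πy≮πx) (λ πx≡πy → x≢y (π-injective (toℕ-injective πx≡πy)))

  value-position : ∀ v → v < suc m → ∃ λ q → entry π q ≡ v
  value-position v v<1+m = Product.map₂ (λ πq≡v → trans (cong toℕ πq≡v) (toℕ-fromℕ< v<1+m))
                                        (injective⇒surjective (lookup π) π-injective (fromℕ< v<1+m))

  Low⇒below-first : ∀ k → Low (suc k) → entry π (suc k) < entry π zero
  Low⇒below-first k bₖ≡false = ≮⇒> (λ ()) (aboveFirst-false π k bₖ≡false)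

  above-first-decreasing : ∀ {x y} → toℕ x < toℕ y → entry π zero < entry π x →
                           ¬ entry π x < entry π y
  above-first-decreasing {zero}  _   π₀<π₀ _     = <-irrefl refl π₀<π₀
  above-first-decreasing {suc i} x<y π₀<πx πx<πy =
    π-avoids-p (contains-p π zero (suc i) _ (s≤s z≤n) x<y π₀<πx πx<πy)

  below-first-decreasing : ∀ {x y} → toℕ x < toℕ y → entry π y < entry π zero →
                           ¬ entry π x < entry π y
  below-first-decreasing x<y πy<π₀ πx<πy =
    no-gap (entry π _ ∸ suc (entry π _)) x<y πy<π₀ (sym (trans (sym (+-suc _ _)) (m∸n+n≡m πx<πy)))
    where
    no-gap : ∀ d {x y} → toℕ x < toℕ y → entry π y < entry π zero →
             entry π y ≡ suc (d + entry π x) → ⊥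
    no-gap d {zero} _ πy<π₀ πy≡ = <-asym πy<π₀ (≤-trans (s≤s (m≤n+m _ d)) (≤-reflexive (sym πy≡)))
    no-gap zero {suc i} {y} x<y πy<π₀ πy≡1+πx =
      π-avoids-r (contains-r π zero (suc i) y (s≤s z≤n) x<y (≤-reflexive (sym πy≡1+πx)) πy<π₀ πy≡1+πx)
    no-gap (suc d) {suc i} {y} x<y πy<π₀ πy≡ =
      Product.uncurry locate (value-position (suc πx) (≤-<-trans 1+πx≤πy (toℕ<n (lookup π y))))
      where
      πx = entry π (suc i)
      1+πx≤πy : suc πx ≤ entry π y
      1+πx≤πy = ≤-trans (s≤s (m≤n+m πx (suc d))) (≤-reflexive (sym πy≡))
      locate : ∀ q → entry π q ≡ suc πx → ⊥
      locate q πq≡1+πx with <-cmp (toℕ q) (toℕ (suc i))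
      ... | tri< q<x _ _ = no-gap d (<-trans q<x x<y) πy<π₀ (begin
        entry π y           ≡⟨ πy≡ ⟩
        suc (suc (d + πx))  ≡⟨ cong suc (+-suc d πx) ⟨
        suc (d + suc πx)    ≡⟨ cong (λ v → suc (d + v)) πq≡1+πx ⟨
        suc (d + entry π q) ∎)
        where open ≡-Reasoning
      ... | tri≈ _ q≡x _ = <-irrefl (cong (entry π) (sym (toℕ-injective q≡x))) (≤-reflexive (sym πq≡1+πx))
      ... | tri> _ _ x<q = π-avoids-r (contains-r π zero (suc i) q (s≤s z≤n) x<q
                                         (≤-reflexive (sym πq≡1+πx)) (<-trans πq<πy πy<π₀) πq≡1+πx)
        where
        πq<πy : entry π q < entry π y
        πq<πy = ≤-trans (s≤s (≤-reflexive πq≡1+πx))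
                        (≤-trans (s≤s (s≤s (m≤n+m πx d))) (≤-reflexive (sym πy≡)))

  avoider-respecting : Respecting π
  avoider-respecting zero    (suc j) Hj                 = aboveFirst-true π j Hj
  avoider-respecting (suc i) zero    Li                 = Low⇒below-first i Li
  avoider-respecting (suc i) (suc j) (inj₁ (Li , Hj))   =
    <-trans (Low⇒below-first i Li) (aboveFirst-true π j Hj)
  avoider-respecting (suc i) (suc j) (inj₂ (bᵢ≡bⱼ , j<i)) =
    ≮⇒> (≢-sym (Fin.<⇒≢ (s≤s j<i))) (side (lookup (aboveFirst π) i) refl)
    where
    side : ∀ c → lookup (aboveFirst π) i ≡ c → ¬ entry π (suc j) < entry π (suc i)
    side true  bᵢ = above-first-decreasing (s≤s j<i) (aboveFirst-true π j (trans (sym bᵢ≡bⱼ) bᵢ))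
    side false bᵢ = below-first-decreasing (s≤s j<i) (Low⇒below-first i bᵢ)

module _ {m : ℕ} where
  open ForcedOrder using (module RespectingWord; decode; decode-respecting; respecting-unique)

  toBits : Av-p-r (suc m) → Vec Bool m
  toBits a = aboveFirst (Av-p-r.word a)

  fromBits : Vec Bool m → Av-p-r (suc m)
  fromBits b = av (decode b) respecting⇒unique respecting⇒avoids-p respecting⇒avoids-r
    where open RespectingWord b {decode b} (decode-respecting b)

  -- The proofs stored in an element are irrelevant, so the equation of words is recomputed
  -- from the decidable equality of vectors.
  fromBits∘toBits : ∀ a → fromBits (toBits a) ≡ a
  fromBits∘toBits (av π π-unique π-avoids-p π-avoids-r) =
    av-cong (recompute (Vec.≡-dec Fin._≟_ _ _)
              (respecting-unique (aboveFirst π) (decode-respecting (aboveFirst π))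
                                 (Avoider.avoider-respecting π-unique π-avoids-p π-avoids-r)))
    where
    av-cong : ∀ {π′} → π′ ≡ π → ∀ .{u p′ r′} → av π′ u p′ r′ ≡ av π π-unique π-avoids-p π-avoids-r
    av-cong refl = refl

  Av-p-r↔bits : Av-p-r (suc m) ↔ Vec Bool m
  Av-p-r↔bits = mk↔ₛ′ toBits fromBits toBits∘fromBits fromBits∘toBits
    where
    toBits∘fromBits : ∀ b → toBits (fromBits b) ≡ b
    toBits∘fromBits b = RespectingWord.respecting⇒aboveFirst b {decode b} (decode-respecting b)

Vec-Bool↔Fin-2^ : ∀ m → Vec Bool m ↔ Fin (2 ^ m)
Vec-Bool↔Fin-2^ zero    = mk↔ₛ′ (λ _ → zero) (λ _ → []) (λ { zero → refl }) (λ { [] → refl })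
Vec-Bool↔Fin-2^ (suc m) =
  ↔-trans uncons (↔-trans (↔-sym Fin.2↔Bool ×-↔ Vec-Bool↔Fin-2^ m) (↔-sym (Fin.*↔× {2} {2 ^ m})))
  where
  uncons : Vec Bool (suc m) ↔ (Bool × Vec Bool m)
  uncons = mk↔ₛ′ (λ { (x ∷ xs) → x , xs }) (λ (x , xs) → x ∷ xs) (λ _ → refl) (λ { (x ∷ xs) → refl })

proposition12 : (n : ℕ) → 1 ≤ n → Av-p-r n ↔ Fin (2 ^ (n ∸ 1))
proposition12 (suc m) _ = ↔-trans Av-p-r↔bits (Vec-Bool↔Fin-2^ m)
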